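{- Consider either of the two fused crystal models (Gamma or Delta) described in the context. If a fused vertex configuration is admissible (has nonzero weight) and its bottom edge carries at most one colour, then its top edge carries at most one colour.
   Context: Palette $\mathcal P=\{c_1<\dots<c_m\}$; row parameter $z$. Unfused vertices have a column colour $c_j$; left/right edges carry $\varnothing$ or one colour, top/bottom edges carry $\varnothing$ or $c_j$. Write configurations as (left, top, right, bottom), with $c_i$ a path colour. Unfused crystal Gamma weights (others $0$): $(\varnothing,\varnothing,\varnothing,\varnothing)\mapsto1$; $(c_i,c_j,c_i,c_j)\mapsto 0$ if $i<j$, $z$ if $i=j$, $1$ if $i>j$; $(\varnothing,c_j,\varnothing,c_j)\mapsto0$; $(c_i,\varnothing,c_i,\varnothing)\mapsto z$ if $i=j$, $1$ otherwise; $(c_j,\varnothing,\varnothing,c_j)\mapsto z$; $(\varnothing,c_j,c_j,\varnothing)\mapsto1$. Unfused crystal Delta weights (others $0$): $(\varnothing,\varnothing,\varnothing,\varnothing)\mapsto1$; $(c_i,c_j,c_i,c_j)\mapsto1$ if $i<j$, $z^{ -1}$ if $i=j$, $0$ if $i>j$; $(\varnothing,c_j,\varnothing,c_j)\mapsto0$; $(c_i,\varnothing,c_i,\varnothing)\mapsto z^{ -1}$ if $i=j$, $1$ otherwise; $(\varnothing,\varnothing,c_j,c_j)\mapsto1$; $(c_j,c_j,\varnothing,\varnothing)\mapsto z^{ -1}$. Fusion: a fused vertex has left and right edges carrying $\varnothing$ or one colour ($A$ and $C$), and top and bottom edges carrying subsets $B,D\subseteq\mathcal P$. Its weight is obtained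 by placing $m$ unfused vertices of the same model side by side in a row with column colours $c_1,\dots,c_m$ from left to right, assigning spin $A$ to the leftmost horizontal edge and $C$ to the rightmost, giving the top (bottom) edge of the vertex of colour $c_t$ the spin $c_t$ iff $c_t\in B$ (resp. $c_t\in D$), and summing over all labellings of the $m-1$ internal horizontal edges the product of the $m$ unfused weights. A fused configuration is admissible if this weight is nonzero. -}

module Defs where

open import Data.Nat using (ℕ; zero; suc)
open import Data.Integer using (ℤ; +_; -[1+_]; _+_)
open import Data.Bool using (Bool; true; false)
open import Data.Maybe using (Maybe; nothing; just)
open import Data.Maybe.Properties using () renaming (≡-dec to maybe-≡-dec)
open import Data.Fin using (Fin) renaming (zero to fzero; suc to fsuc)
open import Data.Fin.Properties using (<-cmp) renaming (_≟_ to _≟F_)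
open import Data.Fin.Subset using (Subset)
open import Data.List using (List; []; _∷_; _++_; map; concatMap; allFin)
open import Data.Vec using (Vec; []; _∷_)
open import Relation.Binary.Definitions using (tri<; tri≈; tri>)
open import Relation.Nullary using (yes; no)
open import Relation.Binary.PropositionalEquality using (_≢_)

-- Laurent polynomials in z with natural-number coefficients,
-- represented as a formal sum (multiset) of monomials z^e, e ∈ ℤ.
-- Every vertex weight of the crystal models lies in ℕ[z, z⁻¹];
-- the zero polynomial is the empty sum.  (Since coefficients are
-- natural numbers there is no cancellation, and a polynomial is zero
-- iff its list of monomials is empty.)

LPoly : Set
LPoly = List ℤ

0ᴾ 1ᴾ zᴾ z⁻¹ᴾ : LPoly
0ᴾ   = []
1ᴾ   = + 0 ∷ []
zᴾ   = + 1 ∷ []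
z⁻¹ᴾ = -[1+ 0 ] ∷ []

_+ᴾ_ : LPoly → LPoly → LPoly
p +ᴾ q = p ++ q

_*ᴾ_ : LPoly → LPoly → LPoly
p *ᴾ q = concatMap (λ a → map (λ b → a + b) q) p

ΣᴾList : {A : Set} → List A → (A → LPoly) → LPoly
ΣᴾList []       f = 0ᴾ
ΣᴾList (x ∷ xs) f = f x +ᴾ ΣᴾList xs f

-- Palette {c_1 < ... < c_m} is Fin m (c_{i+1} ↔ i, order of Fin).
-- Unfused vertical spin for a vertex of column colour c_j:
--   false = ∅, true = c_j.

Spin : ℕ → Set
Spin m = Maybe (Fin m)

data Model : Set where
  Gamma Delta : Model

-- Unfused weight of the vertex with column colour j and configuration
-- (left, top, right, bottom).
unfusedΓ : {m : ℕ} → Fin m → Spin m → Bool → Spin m → Bool → LPoly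
unfusedΓ j nothing  false nothing   false = 1ᴾ
unfusedΓ j (just i) true  (just i') true with i ≟F i'
... | no _ = 0ᴾ
... | yes _ with <-cmp i j
...   | tri< _ _ _ = 0ᴾ
...   | tri≈ _ _ _ = zᴾ
...   | tri> _ _ _ = 1ᴾ
unfusedΓ j nothing  true  nothing   true  = 0ᴾ
unfusedΓ j (just i) false (just i') false with i ≟F i'
... | no _ = 0ᴾ
... | yes _ with i ≟F j
...   | yes _ = zᴾ
...   | no _  = 1ᴾ
unfusedΓ j (just i) false nothing   true with i ≟F j
... | yes _ = zᴾ
... | no _  = 0ᴾ
unfusedΓ j nothing  true  (just i)  false with i ≟F j
... | yes _ = 1ᴾ
... | no _  = 0ᴾ
unfusedΓ j _ _ _ _ = 0ᴾ

unfusedΔ : {m : ℕ} → Fin m → Spin m → Bool → Spin m → Bool → LPoly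
unfusedΔ j nothing  false nothing   false = 1ᴾ
unfusedΔ j (just i) true  (just i') true with i ≟F i'
... | no _ = 0ᴾ
... | yes _ with <-cmp i j
...   | tri< _ _ _ = 1ᴾ
...   | tri≈ _ _ _ = z⁻¹ᴾ
...   | tri> _ _ _ = 0ᴾ
unfusedΔ j nothing  true  nothing   true  = 0ᴾ
unfusedΔ j (just i) false (just i') false with i ≟F i'
... | no _ = 0ᴾ
... | yes _ with i ≟F j
...   | yes _ = z⁻¹ᴾ
...   | no _  = 1ᴾ
unfusedΔ j nothing  false (just i)  true with i ≟F j
... | yes _ = 1ᴾ
... | no _  = 0ᴾ
unfusedΔ j (just i) true  nothing   false with i ≟F j
... | yes _ = z⁻¹ᴾ
... | no _  = 0ᴾ
unfusedΔ j _ _ _ _ = 0ᴾ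

unfused : Model → {m : ℕ} → Fin m → Spin m → Bool → Spin m → Bool → LPoly
unfused Gamma = unfusedΓ
unfused Delta = unfusedΔ

allSpins : (m : ℕ) → List (Spin m)
allSpins m = nothing ∷ map just (allFin m)

rowWeight : Model → {m k : ℕ} → (Fin k → Fin m) →
            Spin m → Vec Bool k → Spin m → Vec Bool k → LPoly
rowWeight M col A []      C []      with maybe-≡-dec _≟F_ A C
... | yes _ = 1ᴾ
... | no _  = 0ᴾ
rowWeight M {m} col A (b ∷ B) C (d ∷ D) =
  ΣᴾList (allSpins m) λ X →
    unfused M (col fzero) A b X d *ᴾ rowWeight M (λ t → col (fsuc t)) X B C D

-- Fused weight of configuration (A, B, C, D) = (left, top, right, bottom):
-- m unfused vertices with column colours c_1, ..., c_m; the top (bottom)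
-- edge of the vertex of colour c_t carries c_t iff c_t ∈ B (resp. D).
fusedWeight : Model → {m : ℕ} → Spin m → Subset m → Spin m → Subset m → LPoly
fusedWeight M {m} A B C D = rowWeight M (λ t → t) A B C D

Admissible : Model → {m : ℕ} → Spin m → Subset m → Spin m → Subset m → Set
Admissible M A B C D = fusedWeight M A B C D ≢ 0ᴾ

-- Read a fused row as lattice paths crossing columns of strictly increasing colour:
-- in Gamma a path enters through a top edge and leaves through a bottom edge, in
-- Delta the other way round, and turning needs the path colour to equal the column
-- colour.  Hence in Gamma from an empty left edge at most one
-- top edge is occupied, and from an occupied one every top edge is matched by a
-- bottom edge; in Delta the path started by the first bottom entry is never
-- absorbed, so tops are outnumbered by bottoms except for the path entering left.
module Submission where

open import Defs
open import Data.Nat using (ℕ; suc; _≤_; _∸_; z≤n; s≤s)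
open import Data.Fin.Subset using (Subset; ∣_∣)

-- Fin's _<_ and _≤_ are the order of toℕ, so the ℕ lemmas apply to them.
open import Data.Nat.Properties using (≤-trans; <⇒≤; <⇒≱; ≤-<-trans; m∸n≤m; ∸-monoˡ-≤)
open import Data.Bool using (Bool; true; false)
open import Data.Maybe using (nothing; just)
open import Data.Fin as Fin using (Fin) renaming (zero to fzero; suc to fsuc)
open import Data.Fin.Properties using (<-cmp; <-irrefl) renaming (_≟_ to _≟F_; ≤-refl to ≤F-refl)
open import Data.List using (List; []; _∷_)
open import Data.Vec using (Vec; []; _∷_)
open import Data.Vec.Functional using (Vector; head; tail)
open import Data.Vec.Functional.Relation.Unary.All using (All)
open import Data.Product using (∃; _×_; _,_)
open import Data.Empty using (⊥-elim)
open import Function using (id; case_of_)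
open import Relation.Binary.Core using (_Preserves_⟶_)
open import Relation.Binary.Definitions using (tri<; tri≈; tri>)
open import Relation.Nullary using (yes; no)
open import Relation.Binary.PropositionalEquality using (_≡_; refl; _≢_; sym; trans)

*ᴾ-zeroʳ : (p : LPoly) → p *ᴾ 0ᴾ ≡ 0ᴾ
*ᴾ-zeroʳ []      = refl
*ᴾ-zeroʳ (_ ∷ p) = *ᴾ-zeroʳ p

*ᴾ-nonzeroˡ : (p q : LPoly) → p *ᴾ q ≢ 0ᴾ → p ≢ 0ᴾ
*ᴾ-nonzeroˡ p q pq≢0 refl = pq≢0 refl

*ᴾ-nonzeroʳ : (p q : LPoly) → p *ᴾ q ≢ 0ᴾ → q ≢ 0ᴾ
*ᴾ-nonzeroʳ p q pq≢0 refl = pq≢0 (*ᴾ-zeroʳ p)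

Σᴾ-nonzero⇒∃-nonzero : {A : Set} (xs : List A) (f : A → LPoly) →
  ΣᴾList xs f ≢ 0ᴾ → ∃ λ x → f x ≢ 0ᴾ
Σᴾ-nonzero⇒∃-nonzero []       f Σ≢0 = ⊥-elim (Σ≢0 refl)
Σᴾ-nonzero⇒∃-nonzero (x ∷ xs) f Σ≢0 with f x in fx≡
... | []    = Σᴾ-nonzero⇒∃-nonzero xs f Σ≢0
... | _ ∷ _ = x , λ fx≡0 → case trans (sym fx≡) fx≡0 of λ ()

data ΓVertex {m : ℕ} (j : Fin m) : Spin m → Bool → Spin m → Bool → Set where
  empty       : ΓVertex j nothing false nothing false
  cross       : ∀ i → j Fin.≤ i → ΓVertex j (just i) true (just i) true
  pass        : ∀ i → ΓVertex j (just i) false (just i) false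
  exit-bottom : ΓVertex j (just j) false nothing true
  enter-top   : ΓVertex j nothing true (just j) false

data ΔVertex {m : ℕ} (j : Fin m) : Spin m → Bool → Spin m → Bool → Set where
  empty        : ΔVertex j nothing false nothing false
  cross        : ∀ i → i Fin.≤ j → ΔVertex j (just i) true (just i) true
  pass         : ∀ i → ΔVertex j (just i) false (just i) false
  enter-bottom : ΔVertex j nothing false (just j) true
  exit-top     : ΔVertex j (just j) true nothing false

Vertex : Model → {m : ℕ} → Fin m → Spin m → Bool → Spin m → Bool → Set
Vertex Gamma = ΓVertex
Vertex Delta = ΔVertex

Γ-vertex : ∀ {m} (j : Fin m) A b C d → unfusedΓ j A b C d ≢ 0ᴾ → ΓVertex j A b C d
Γ-vertex j nothing  false nothing   false _ = empty
Γ-vertex j (just i) true  (just i') true  w≢0 with i ≟F i'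
... | no _     = ⊥-elim (w≢0 refl)
... | yes refl with <-cmp i j
...   | tri< _ _ _    = ⊥-elim (w≢0 refl)
...   | tri≈ _ refl _ = cross i ≤F-refl
...   | tri> _ _ j<i  = cross i (<⇒≤ j<i)
Γ-vertex j (just i) false (just i') false w≢0 with i ≟F i'
... | no _     = ⊥-elim (w≢0 refl)
... | yes refl = pass i
Γ-vertex j (just i) false nothing true w≢0 with i ≟F j
... | yes refl = exit-bottom
... | no _     = ⊥-elim (w≢0 refl)
Γ-vertex j nothing true (just i) false w≢0 with i ≟F j
... | yes refl = enter-top
... | no _     = ⊥-elim (w≢0 refl)
Γ-vertex j nothing  true  nothing  true  w≢0 = ⊥-elim (w≢0 refl)
Γ-vertex j nothing  false nothing  true  w≢0 = ⊥-elim (w≢0 refl)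
Γ-vertex j nothing  false (just _) _     w≢0 = ⊥-elim (w≢0 refl)
Γ-vertex j nothing  true  nothing  false w≢0 = ⊥-elim (w≢0 refl)
Γ-vertex j nothing  true  (just _) true  w≢0 = ⊥-elim (w≢0 refl)
Γ-vertex j (just _) false nothing  false w≢0 = ⊥-elim (w≢0 refl)
Γ-vertex j (just _) false (just _) true  w≢0 = ⊥-elim (w≢0 refl)
Γ-vertex j (just _) true  nothing  _     w≢0 = ⊥-elim (w≢0 refl)
Γ-vertex j (just _) true  (just _) false w≢0 = ⊥-elim (w≢0 refl)

Δ-vertex : ∀ {m} (j : Fin m) A b C d → unfusedΔ j A b C d ≢ 0ᴾ → ΔVertex j A b C d
Δ-vertex j nothing  false nothing   false _ = empty
Δ-vertex j (just i) true  (just i') true  w≢0 with i ≟F i'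
... | no _     = ⊥-elim (w≢0 refl)
... | yes refl with <-cmp i j
...   | tri< i<j _ _  = cross i (<⇒≤ i<j)
...   | tri≈ _ refl _ = cross i ≤F-refl
...   | tri> _ _ _    = ⊥-elim (w≢0 refl)
Δ-vertex j (just i) false (just i') false w≢0 with i ≟F i'
... | no _     = ⊥-elim (w≢0 refl)
... | yes refl = pass i
Δ-vertex j nothing false (just i) true w≢0 with i ≟F j
... | yes refl = enter-bottom
... | no _     = ⊥-elim (w≢0 refl)
Δ-vertex j (just i) true nothing false w≢0 with i ≟F j
... | yes refl = exit-top
... | no _     = ⊥-elim (w≢0 refl)
Δ-vertex j nothing  true  nothing  true  w≢0 = ⊥-elim (w≢0 refl)
Δ-vertex j nothing  false nothing  true  w≢0 = ⊥-elim (w≢0 refl)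
Δ-vertex j nothing  false (just _) false w≢0 = ⊥-elim (w≢0 refl)
Δ-vertex j nothing  true  nothing  false w≢0 = ⊥-elim (w≢0 refl)
Δ-vertex j nothing  true  (just _) _     w≢0 = ⊥-elim (w≢0 refl)
Δ-vertex j (just _) false nothing  _     w≢0 = ⊥-elim (w≢0 refl)
Δ-vertex j (just _) false (just _) true  w≢0 = ⊥-elim (w≢0 refl)
Δ-vertex j (just _) true  nothing  true  w≢0 = ⊥-elim (w≢0 refl)
Δ-vertex j (just _) true  (just _) false w≢0 = ⊥-elim (w≢0 refl)

vertex : ∀ M {m} (j : Fin m) A b C d → unfused M j A b C d ≢ 0ᴾ → Vertex M j A b C d
vertex Gamma = Γ-vertex
vertex Delta = Δ-vertex

AdmissibleRow : Model → {m k : ℕ} → Vector (Fin m) k →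
                Spin m → Vec Bool k → Spin m → Vec Bool k → Set
AdmissibleRow M col A B C D = rowWeight M col A B C D ≢ 0ᴾ

AdmissibleRow-uncons : ∀ M {m k} (col : Vector (Fin m) (suc k)) A b B C d D →
  AdmissibleRow M col A (b ∷ B) C (d ∷ D) →
  ∃ λ X → Vertex M (head col) A b X d × AdmissibleRow M (tail col) X B C D
AdmissibleRow-uncons M {m} col A b B C d D row≢0
  with Σᴾ-nonzero⇒∃-nonzero (allSpins m) _ row≢0
... | X , term≢0 =
  X , vertex M (head col) A b X d (*ᴾ-nonzeroˡ (unfused M (head col) A b X d) _ term≢0)
    , *ᴾ-nonzeroʳ (unfused M (head col) A b X d) _ term≢0

Increasing : {m k : ℕ} → Vector (Fin m) k → Set
Increasing col = col Preserves Fin._<_ ⟶ Fin._<_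

Increasing-tail : ∀ {m k} {col : Vector (Fin m) (suc k)} →
  Increasing col → Increasing (tail col)
Increasing-tail inc s<t = inc (s≤s s<t)

Increasing-head< : ∀ {m k} {col : Vector (Fin m) (suc k)} →
  Increasing col → All (head col Fin.<_) (tail col)
Increasing-head< inc t = inc (s≤s z≤n)

Γ-low-path⇒∣B∣≡0 : ∀ {m k} (col : Vector (Fin m) k) a B C D →
  All (a Fin.<_) col → AdmissibleRow Gamma col (just a) B C D → ∣ B ∣ ≡ 0
Γ-low-path⇒∣B∣≡0 col a []      C []      a<col row = refl
Γ-low-path⇒∣B∣≡0 col a (b ∷ B) C (d ∷ D) a<col row
  with AdmissibleRow-uncons Gamma col (just a) b B C d D row
... | _ , cross .a col₀≤a , _    = ⊥-elim (<⇒≱ (a<col fzero) col₀≤a)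
... | _ , pass .a         , rest = Γ-low-path⇒∣B∣≡0 (tail col) a B C D (λ t → a<col (fsuc t)) rest
... | _ , exit-bottom     , _    = ⊥-elim (<-irrefl refl (a<col fzero))

Γ-left-∅⇒∣B∣≤1 : ∀ {m k} (col : Vector (Fin m) k) B C D →
  Increasing col → AdmissibleRow Gamma col nothing B C D → ∣ B ∣ ≤ 1
Γ-left-∅⇒∣B∣≤1 col []      C []      inc row = z≤n
Γ-left-∅⇒∣B∣≤1 col (b ∷ B) C (d ∷ D) inc row
  with AdmissibleRow-uncons Gamma col nothing b B C d D row
... | _ , empty     , rest = Γ-left-∅⇒∣B∣≤1 (tail col) B C D (Increasing-tail inc) rest
... | _ , enter-top , rest
  rewrite Γ-low-path⇒∣B∣≡0 (tail col) (head col) B C D (Increasing-head< inc) rest = s≤s z≤n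

Γ-left-path⇒∣B∣≤∣D∣ : ∀ {m k} (col : Vector (Fin m) k) a B C D →
  Increasing col → AdmissibleRow Gamma col (just a) B C D → ∣ B ∣ ≤ ∣ D ∣
Γ-left-path⇒∣B∣≤∣D∣ col a []      C []      inc row = z≤n
Γ-left-path⇒∣B∣≤∣D∣ col a (b ∷ B) C (d ∷ D) inc row
  with AdmissibleRow-uncons Gamma col (just a) b B C d D row
... | _ , cross .a _  , rest = s≤s (Γ-left-path⇒∣B∣≤∣D∣ (tail col) a B C D (Increasing-tail inc) rest)
... | _ , pass .a     , rest = Γ-left-path⇒∣B∣≤∣D∣ (tail col) a B C D (Increasing-tail inc) rest
... | _ , exit-bottom , rest = ≤-trans (Γ-left-∅⇒∣B∣≤1 (tail col) B C D (Increasing-tail inc) rest) (s≤s z≤n)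

Δ-low-path⇒∣B∣≤∣D∣ : ∀ {m k} (col : Vector (Fin m) k) a B C D →
  All (a Fin.<_) col → AdmissibleRow Delta col (just a) B C D → ∣ B ∣ ≤ ∣ D ∣
Δ-low-path⇒∣B∣≤∣D∣ col a []      C []      a<col row = z≤n
Δ-low-path⇒∣B∣≤∣D∣ col a (b ∷ B) C (d ∷ D) a<col row
  with AdmissibleRow-uncons Delta col (just a) b B C d D row
... | _ , cross .a _ , rest = s≤s (Δ-low-path⇒∣B∣≤∣D∣ (tail col) a B C D (λ t → a<col (fsuc t)) rest)
... | _ , pass .a    , rest = Δ-low-path⇒∣B∣≤∣D∣ (tail col) a B C D (λ t → a<col (fsuc t)) rest
... | _ , exit-top   , _    = ⊥-elim (<-irrefl refl (a<col fzero))

Δ-left-∅⇒∣B∣≤∣D∣∸1 : ∀ {m k} (col : Vector (Fin m) k) B C D →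
  Increasing col → AdmissibleRow Delta col nothing B C D → ∣ B ∣ ≤ ∣ D ∣ ∸ 1
Δ-left-∅⇒∣B∣≤∣D∣∸1 col []      C []      inc row = z≤n
Δ-left-∅⇒∣B∣≤∣D∣∸1 col (b ∷ B) C (d ∷ D) inc row
  with AdmissibleRow-uncons Delta col nothing b B C d D row
... | _ , empty        , rest = Δ-left-∅⇒∣B∣≤∣D∣∸1 (tail col) B C D (Increasing-tail inc) rest
... | _ , enter-bottom , rest = Δ-low-path⇒∣B∣≤∣D∣ (tail col) (head col) B C D (Increasing-head< inc) rest

Δ-left-path⇒∣B∣≤1+[∣D∣∸1] : ∀ {m k} (col : Vector (Fin m) k) a B C D →
  Increasing col → AdmissibleRow Delta col (just a) B C D → ∣ B ∣ ≤ suc (∣ D ∣ ∸ 1)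
Δ-left-path⇒∣B∣≤1+[∣D∣∸1] col a []      C []      inc row = z≤n
Δ-left-path⇒∣B∣≤1+[∣D∣∸1] col a (b ∷ B) C (d ∷ D) inc row
  with AdmissibleRow-uncons Delta col (just a) b B C d D row
... | _ , cross .a a≤col₀ , rest =
  s≤s (Δ-low-path⇒∣B∣≤∣D∣ (tail col) a B C D (λ t → ≤-<-trans a≤col₀ (Increasing-head< inc t)) rest)
... | _ , pass .a , rest = Δ-left-path⇒∣B∣≤1+[∣D∣∸1] (tail col) a B C D (Increasing-tail inc) rest
... | _ , exit-top , rest = s≤s (Δ-left-∅⇒∣B∣≤∣D∣∸1 (tail col) B C D (Increasing-tail inc) rest)

lemma2p2 : (M : Model) (m : ℕ) (A C : Spin m) (B D : Subset m) →
    Admissible M A B C D → ∣ D ∣ ≤ 1 → ∣ B ∣ ≤ 1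
lemma2p2 Gamma m nothing  C B D adm _     = Γ-left-∅⇒∣B∣≤1 id B C D id adm
lemma2p2 Gamma m (just a) C B D adm ∣D∣≤1 =
  ≤-trans (Γ-left-path⇒∣B∣≤∣D∣ id a B C D id adm) ∣D∣≤1
lemma2p2 Delta m nothing  C B D adm ∣D∣≤1 =
  ≤-trans (Δ-left-∅⇒∣B∣≤∣D∣∸1 id B C D id adm) (≤-trans (m∸n≤m ∣ D ∣ 1) ∣D∣≤1)
lemma2p2 Delta m (just a) C B D adm ∣D∣≤1 =
  ≤-trans (Δ-left-path⇒∣B∣≤1+[∣D∣∸1] id a B C D id adm) (s≤s (∸-monoˡ-≤ 1 ∣D∣≤1))
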